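{- Let $d$ be an integer with $\sqrt{d}\notin\mathbb{Q}$, and let $f\colon\mathbb{Q}(\sqrt{d})\to\mathbb{Q}(\sqrt{d})$ be an SD map. Then $f(z)=z$ for all $z\in\mathbb{Q}(\sqrt{d})$, or $f(z)=\overline{z}$ for all $z\in\mathbb{Q}(\sqrt{d})$.
   Context: An SD map on a field $\mathbb{F}$ is a function $f\colon \mathbb{F}\to\mathbb{F}$ such that for all $x \neq y$ in $\mathbb{F}$ one has $f(x)\neq f(y)$ and $f\left(\frac{x+y}{x-y}\right) = \frac{f(x)+f(y)}{f(x)-f(y)}$. Conjugation on $\mathbb{Q}(\sqrt{d})$ is defined by $\overline{a+b\sqrt{d}}=a-b\sqrt{d}$ for $a,b\in\mathbb{Q}$. -}

module Defs where

open import Data.Integer using (ℤ)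
open import Data.Rational using (ℚ; 0ℚ; _+_; _*_; _-_; -_; 1/_; _/_; ≢-nonZero; _≟_)
open import Relation.Nullary using (yes; no)
open import Relation.Binary.PropositionalEquality using (_≡_; _≢_)
open import Data.Product using (Σ)

ℤtoℚ : ℤ → ℚ
ℤtoℚ z = z / 1

IrrationalSqrt : ℤ → Set
IrrationalSqrt d = (q : ℚ) → q * q ≢ ℤtoℚ d

record QSqrt (d : ℤ) : Set where
  constructor _+√d·_
  field
    re : ℚ
    im : ℚ
open QSqrt public

module _ {d : ℤ} where
  private D = ℤtoℚ d

  _⊕_ : QSqrt d → QSqrt d → QSqrt d
  (a +√d· b) ⊕ (c +√d· e) = (a + c) +√d· (b + e)

  ⊖_ : QSqrt d → QSqrt d
  ⊖ (a +√d· b) = (- a) +√d· (- b)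

  _⊖_ : QSqrt d → QSqrt d → QSqrt d
  x ⊖ y = x ⊕ (⊖ y)

  _⊗_ : QSqrt d → QSqrt d → QSqrt d
  (a +√d· b) ⊗ (c +√d· e) = (a * c + D * (b * e)) +√d· (a * e + b * c)

  -- total rational inverse with 0⁻¹ = 0 (only used at nonzero arguments)
  qinv : ℚ → ℚ
  qinv q with q ≟ 0ℚ
  ... | yes _ = 0ℚ
  ... | no q≢0 = 1/_ q {{≢-nonZero q≢0}}

  conj : QSqrt d → QSqrt d
  conj (a +√d· b) = a +√d· (- b)

  -- (c + e√d)⁻¹ = (c - e√d)/(c² - d e²); the norm is nonzero for nonzero
  -- elements when √d ∉ ℚ; 0⁻¹ = 0 by convention (never used below).
  inv : QSqrt d → QSqrt d
  inv (c +√d· e) = let n = qinv (c * c - D * (e * e)) in (c * n) +√d· (- (e * n))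

  _⊘_ : QSqrt d → QSqrt d → QSqrt d
  x ⊘ y = x ⊗ inv y

IsSDMap : (d : ℤ) → (QSqrt d → QSqrt d) → Set
IsSDMap d f = (x y : QSqrt d) → x ≢ y →
  Σ (f x ≢ f y) (λ _ → f ((x ⊕ y) ⊘ (x ⊖ y)) ≡ (f x ⊕ f y) ⊘ (f x ⊖ f y))

-- Clearing denominators, the SD identity says f u · (f x − f y) = f x + f y whenever
-- x + y = u · (x − y). At suitable points this gives f 0 = 0, f 1 = 1, f (−1) = −1, multiplicativity
-- (use u = (y + 1)/(y − 1) for the pairs (y, 1) and (xy, x)) and the recurrence
-- f (v + 1) · (f v − 1) = f (v − 1) · (f v + 1). The recurrence at 2, 4 and 5, with f 4 = (f 2)² and
-- f 6 = f 2 · f 3, forces f 2 = 2; it then propagates along ℕ, and multiplicativity makes f fix ℚ.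
-- Hence f (√d)² = d and f (√d) = s√d with s = ±1. For v = q√d, the recurrence together with
-- f (v² − 1) = v² − 1 gives f (v + 1) = ±(qs√d + 1); the wrong sign would, by the recurrence at 2v + 1,
-- make (2qs√d + 1)² = ±1, whose √d-part 4qs is not 0. Finally a + b√d = a · ((b/a)√d + 1).

module Submission where

open import Defs
open import Algebra.Bundles using (CommutativeRing)
open import Algebra.Consequences.Propositional using (comm∧idˡ⇒id; comm∧invˡ⇒inv; comm∧distrˡ⇒distrʳ)
open import Algebra.Core using (Op₁; Op₂)
open import Algebra.Structures using (IsCommutativeRing)
open import Data.Empty using (⊥; ⊥-elim)
open import Data.Integer as ℤ using (ℤ; +_; -[1+_])
import Data.Integer.Tactic.RingSolver as ℤ-Solver
open import Data.List using (_∷_; [])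
open import Data.Nat using (ℕ; zero; suc)
open import Data.Product using (∃; _×_; _,_; proj₁; proj₂)
open import Data.Rational as ℚ using (ℚ; mkℚ; 0ℚ; 1ℚ; 1/_; ↥_; ↧_; ≢-nonZero; toℚᵘ)
import Data.Rational.Properties as ℚ
import Data.Rational.Unnormalised as ℚᵘ
import Data.Rational.Unnormalised.Properties as ℚᵘ
open import Data.Sum as Sum using (_⊎_; inj₁; inj₂; [_,_]′)
open import Function using (id; _∘_)
open import Level using (0ℓ)
open import Relation.Binary.Definitions using (DecidableEquality)
open import Relation.Binary.PropositionalEquality
open import Relation.Nullary using (yes; no)
open import Relation.Nullary.Decidable using (dec⇒maybe; map′; _×-dec_)
import Tactic.RingSolver as Solver
open import Tactic.RingSolver.Core.AlmostCommutativeRing using (AlmostCommutativeRing; fromCommutativeRing)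

module DiscreteField
  {a} {F : Set a} {_+ᶠ_ _*ᶠ_ : Op₂ F} { -ᶠ_ : Op₁ F} {0ᶠ 1ᶠ : F}
  (isCommutativeRing : IsCommutativeRing _≡_ _+ᶠ_ _*ᶠ_ -ᶠ_ 0ᶠ 1ᶠ)
  (_≟_ : DecidableEquality F)
  (*-inverse : ∀ {x} → x ≢ 0ᶠ → ∃ λ y → x *ᶠ y ≡ 1ᶠ)
  where

  commutativeRing : CommutativeRing a a
  commutativeRing = record { isCommutativeRing = isCommutativeRing }

  open CommutativeRing commutativeRing
    using (_+_; _*_; -_; _-_; 0#; 1#; zeroˡ; *-identityʳ; *-comm; +-group; *-commutativeSemigroup; ring)
  open import Algebra.Properties.Group +-group using (x∙y⁻¹≈ε⇒x≈y; x≈y⇒x∙y⁻¹≈ε)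
  open import Algebra.Properties.Ring ring using ([y-z]x≈yx-zx)
  open import Algebra.Properties.CommutativeSemigroup *-commutativeSemigroup
    using (xy∙z≈x∙zy; xy∙z≈zx∙y)

  x-y≡0⇒x≡y : ∀ {x y} → x - y ≡ 0# → x ≡ y
  x-y≡0⇒x≡y = x∙y⁻¹≈ε⇒x≈y _ _

  x≡y⇒x-y≡0 : ∀ {x y} → x ≡ y → x - y ≡ 0#
  x≡y⇒x-y≡0 = x≈y⇒x∙y⁻¹≈ε

  *-inverse-cancelʳ : ∀ {x y y′} → y * y′ ≡ 1# → (x * y′) * y ≡ x
  *-inverse-cancelʳ {x} {y} {y′} yy′≡1 = begin
    (x * y′) * y  ≡⟨ xy∙z≈x∙zy x y′ y ⟩
    x * (y * y′)  ≡⟨ cong (x *_) yy′≡1 ⟩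
    x * 1#        ≡⟨ *-identityʳ x ⟩
    x             ∎
    where open ≡-Reasoning

  x*y≡0⇒y≡0 : ∀ {x y} → x ≢ 0# → x * y ≡ 0# → y ≡ 0#
  x*y≡0⇒y≡0 {x} {y} x≢0 xy≡0 = begin
    y              ≡⟨ *-inverse-cancelʳ (proj₂ (*-inverse x≢0)) ⟨
    (y * x⁻¹) * x  ≡⟨ xy∙z≈zx∙y y x⁻¹ x ⟩
    (x * y) * x⁻¹  ≡⟨ cong (_* x⁻¹) xy≡0 ⟩
    0# * x⁻¹       ≡⟨ zeroˡ x⁻¹ ⟩
    0#             ∎
    where
    open ≡-Reasoning
    x⁻¹ = proj₁ (*-inverse x≢0)

  x*y≡0⇒x≡0∨y≡0 : ∀ {x y} → x * y ≡ 0# → x ≡ 0# ⊎ y ≡ 0#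
  x*y≡0⇒x≡0∨y≡0 {x} xy≡0 with x ≟ 0#
  ... | yes x≡0 = inj₁ x≡0
  ... | no x≢0  = inj₂ (x*y≡0⇒y≡0 x≢0 xy≡0)

  x*y≢0 : ∀ {x y} → x ≢ 0# → y ≢ 0# → x * y ≢ 0#
  x*y≢0 x≢0 y≢0 = [ x≢0 , y≢0 ]′ ∘ x*y≡0⇒x≡0∨y≡0

  *-cancelʳ-≢0 : ∀ {x y z} → z ≢ 0# → x * z ≡ y * z → x ≡ y
  *-cancelʳ-≢0 {x} {y} {z} z≢0 xz≡yz = x-y≡0⇒x≡y (x*y≡0⇒y≡0 z≢0 (begin
    z * (x - y)    ≡⟨ *-comm z (x - y) ⟩
    (x - y) * z    ≡⟨ [y-z]x≈yx-zx z x y ⟩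
    x * z - y * z  ≡⟨ x≡y⇒x-y≡0 xz≡yz ⟩
    0#             ∎))
    where open ≡-Reasoning

  *-cancelˡ-≢0 : ∀ {x y z} → z ≢ 0# → z * x ≡ z * y → x ≡ y
  *-cancelˡ-≢0 {x} {y} {z} z≢0 zx≡zy = *-cancelʳ-≢0 z≢0 (begin
    x * z  ≡⟨ *-comm x z ⟩
    z * x  ≡⟨ zx≡zy ⟩
    z * y  ≡⟨ *-comm z y ⟩
    y * z  ∎)
    where open ≡-Reasoning

ℚ-ring : AlmostCommutativeRing 0ℓ 0ℓ
ℚ-ring = fromCommutativeRing ℚ.+-*-commutativeRing (λ x → dec⇒maybe (0ℚ ℚ.≟ x))

toℚᵘ-ℤtoℚ : ∀ i → toℚᵘ (ℤtoℚ i) ℚᵘ.≃ ℚᵘ.mkℚᵘ i 0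
toℚᵘ-ℤtoℚ i = ℚ.toℚᵘ-fromℚᵘ (ℚᵘ.mkℚᵘ i 0)

ℤtoℚ-+ : ∀ i j → ℤtoℚ (i ℤ.+ j) ≡ ℤtoℚ i ℚ.+ ℤtoℚ j
ℤtoℚ-+ i j = ℚ.toℚᵘ-injective (begin
  toℚᵘ (ℤtoℚ (i ℤ.+ j))              ≈⟨ toℚᵘ-ℤtoℚ (i ℤ.+ j) ⟩
  ℚᵘ.mkℚᵘ (i ℤ.+ j) 0               ≈⟨ ℚᵘ.*≡* (identity i j) ⟩
  ℚᵘ.mkℚᵘ i 0 ℚᵘ.+ ℚᵘ.mkℚᵘ j 0       ≈⟨ ℚᵘ.+-cong (toℚᵘ-ℤtoℚ i) (toℚᵘ-ℤtoℚ j) ⟨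
  toℚᵘ (ℤtoℚ i) ℚᵘ.+ toℚᵘ (ℤtoℚ j)   ≈⟨ ℚ.toℚᵘ-homo-+ (ℤtoℚ i) (ℤtoℚ j) ⟨
  toℚᵘ (ℤtoℚ i ℚ.+ ℤtoℚ j)          ∎)
  where
  open ℚᵘ.≃-Reasoning
  identity : ∀ i j → (i ℤ.+ j) ℤ.* (+ 1 ℤ.* + 1) ≡ (i ℤ.* + 1 ℤ.+ j ℤ.* + 1) ℤ.* + 1
  identity = ℤ-Solver.solve-∀

*-ℤtoℚ-↧ : ∀ q → q ℚ.* ℤtoℚ (↧ q) ≡ ℤtoℚ (↥ q)
*-ℤtoℚ-↧ q@(mkℚ n d-1 _) = ℚ.toℚᵘ-injective (begin
  toℚᵘ (q ℚ.* ℤtoℚ (↧ q))             ≈⟨ ℚ.toℚᵘ-homo-* q (ℤtoℚ (↧ q)) ⟩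
  ℚᵘ.mkℚᵘ n d-1 ℚᵘ.* toℚᵘ (ℤtoℚ (↧ q)) ≈⟨ ℚᵘ.*-congˡ {ℚᵘ.mkℚᵘ n d-1} (toℚᵘ-ℤtoℚ (↧ q)) ⟩
  ℚᵘ.mkℚᵘ n d-1 ℚᵘ.* ℚᵘ.mkℚᵘ (↧ q) 0    ≈⟨ ℚᵘ.*≡* (identity n (↧ q)) ⟩
  ℚᵘ.mkℚᵘ n 0                          ≈⟨ toℚᵘ-ℤtoℚ n ⟨
  toℚᵘ (ℤtoℚ (↥ q))                    ∎)
  where
  open ℚᵘ.≃-Reasoning
  identity : ∀ n m → (n ℤ.* m) ℤ.* + 1 ≡ n ℤ.* (m ℤ.* + 1)
  identity = ℤ-Solver.solve-∀

ℤtoℚ-+[1+n]≢0 : ∀ n → ℤtoℚ (+ suc n) ≢ 0ℚ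
ℤtoℚ-+[1+n]≢0 n eq with ℚᵘ.≃-trans (ℚᵘ.≃-sym (toℚᵘ-ℤtoℚ (+ suc n))) (ℚ.toℚᵘ-cong eq)
... | ℚᵘ.*≡* ()

ℚ-*-inverse : ∀ {x} → x ≢ 0ℚ → ∃ λ y → x ℚ.* y ≡ 1ℚ
ℚ-*-inverse {x} x≢0 = 1/ x , ℚ.*-inverseʳ x
  where instance _ = ≢-nonZero x≢0

module ℚ-Field = DiscreteField ℚ.+-*-isCommutativeRing ℚ._≟_ ℚ-*-inverse

x+x≢0 : ∀ {x} → x ≢ 0ℚ → x ℚ.+ x ≢ 0ℚ
x+x≢0 {x} x≢0 x+x≡0 = ℚ-Field.x*y≢0 x≢0 (λ ()) (begin
  x ℚ.* (1ℚ ℚ.+ 1ℚ)  ≡⟨ Solver.solve (x ∷ []) ℚ-ring ⟩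
  x ℚ.+ x            ≡⟨ x+x≡0 ⟩
  0ℚ                 ∎)
  where open ≡-Reasoning

module QuadraticField (d : ℤ) where

  open import Data.Rational using (_+_; _*_; -_; _-_)

  D : ℚ
  D = ℤtoℚ d

  ι : ℚ → QSqrt d
  ι q = q +√d· 0ℚ

  infix 30 _·√d
  _·√d : ℚ → QSqrt d
  q ·√d = 0ℚ +√d· q

  0# 1# √d : QSqrt d
  0# = ι 0ℚ
  1# = ι 1ℚ
  √d = 1ℚ ·√d

  ⟦_⟧ : ℕ → QSqrt d
  ⟦ n ⟧ = ι (ℤtoℚ (+ n))

  _≟_ : DecidableEquality (QSqrt d)
  x ≟ y = map′ (λ (p , q) → cong₂ _+√d·_ p q) (λ x≡y → cong re x≡y , cong im x≡y)
               (re x ℚ.≟ re y ×-dec im x ℚ.≟ im y)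

  -- D· x equals D * x but reduces to 0ℚ on the closed value 0ℚ, so that products of closed elements
  -- compute under _⊙_ (unlike _⊗_); Tactic.RingSolver needs this to evaluate constants.
  D·_ : ℚ → ℚ
  D· x with x ℚ.≟ 0ℚ
  ... | yes _ = 0ℚ
  ... | no _  = D * x

  D·≡D* : ∀ x → D· x ≡ D * x
  D·≡D* x with x ℚ.≟ 0ℚ
  ... | yes refl = sym (ℚ.*-zeroʳ D)
  ... | no _     = refl

  infixl 25 _⊙_
  _⊙_ : Op₂ (QSqrt d)
  (a +√d· b) ⊙ (c +√d· e) = (a * c + D· (b * e)) +√d· (a * e + b * c)

  ⊙≡⊗ : ∀ x y → x ⊙ y ≡ x ⊗ y
  ⊙≡⊗ (a +√d· b) (c +√d· e) = cong (λ z → (a * c + z) +√d· (a * e + b * c)) (D·≡D* (b * e))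

  isCommutativeRing : IsCommutativeRing _≡_ _⊕_ _⊙_ (λ x → ⊖ x) 0# 1#
  isCommutativeRing = record
    { isRing = record
      { +-isAbelianGroup = record
        { isGroup = record
          { isMonoid = record
            { isSemigroup = record
              { isMagma = record { isEquivalence = isEquivalence ; ∙-cong = cong₂ _⊕_ }
              ; assoc = ⊕-assoc
              }
            ; identity = comm∧idˡ⇒id ⊕-comm ⊕-identityˡ
            }
          ; inverse = comm∧invˡ⇒inv ⊕-comm ⊕-inverseˡ
          ; ⁻¹-cong = cong (λ x → ⊖ x)
          }
        ; comm = ⊕-comm
        }
      ; *-cong = cong₂ _⊙_
      ; *-assoc = ⊙-assoc
      ; *-identity = comm∧idˡ⇒id ⊙-comm ⊙-identityˡ
      ; distrib = ⊙-distribˡ-⊕ , comm∧distrˡ⇒distrʳ ⊙-comm ⊙-distribˡ-⊕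
      }
    ; *-comm = ⊙-comm
    }
    where
    ⊕-assoc : ∀ x y z → (x ⊕ y) ⊕ z ≡ x ⊕ (y ⊕ z)
    ⊕-assoc x y z = cong₂ _+√d·_ (ℚ.+-assoc (re x) (re y) (re z)) (ℚ.+-assoc (im x) (im y) (im z))

    ⊕-comm : ∀ x y → x ⊕ y ≡ y ⊕ x
    ⊕-comm x y = cong₂ _+√d·_ (ℚ.+-comm (re x) (re y)) (ℚ.+-comm (im x) (im y))

    ⊕-identityˡ : ∀ x → 0# ⊕ x ≡ x
    ⊕-identityˡ x = cong₂ _+√d·_ (ℚ.+-identityˡ (re x)) (ℚ.+-identityˡ (im x))

    ⊕-inverseˡ : ∀ x → (⊖ x) ⊕ x ≡ 0#
    ⊕-inverseˡ x = cong₂ _+√d·_ (ℚ.+-inverseˡ (re x)) (ℚ.+-inverseˡ (im x))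

    ⊗-assoc : ∀ x y z → (x ⊗ y) ⊗ z ≡ x ⊗ (y ⊗ z)
    ⊗-assoc (a +√d· b) (c +√d· e) (g +√d· h) =
      cong₂ _+√d·_ (re-identity D a b c e g h) (im-identity D a b c e g h)
      where
      re-identity : ∀ D a b c e g h → (a * c + D * (b * e)) * g + D * ((a * e + b * c) * h)
                           ≡ a * (c * g + D * (e * h)) + D * (b * (c * h + e * g))
      re-identity = Solver.solve-∀ ℚ-ring
      im-identity : ∀ D a b c e g h → (a * c + D * (b * e)) * h + (a * e + b * c) * g
                           ≡ a * (c * h + e * g) + b * (c * g + D * (e * h))
      im-identity = Solver.solve-∀ ℚ-ring

    ⊙-assoc : ∀ x y z → (x ⊙ y) ⊙ z ≡ x ⊙ (y ⊙ z)
    ⊙-assoc x y z = begin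
      (x ⊙ y) ⊙ z  ≡⟨ ⊙≡⊗ (x ⊙ y) z ⟩
      (x ⊙ y) ⊗ z  ≡⟨ cong (_⊗ z) (⊙≡⊗ x y) ⟩
      (x ⊗ y) ⊗ z  ≡⟨ ⊗-assoc x y z ⟩
      x ⊗ (y ⊗ z)  ≡⟨ cong (x ⊗_) (⊙≡⊗ y z) ⟨
      x ⊗ (y ⊙ z)  ≡⟨ ⊙≡⊗ x (y ⊙ z) ⟨
      x ⊙ (y ⊙ z)  ∎
      where open ≡-Reasoning

    ⊙-comm : ∀ x y → x ⊙ y ≡ y ⊙ x
    ⊙-comm x@(a +√d· b) y@(c +√d· e) = begin
      x ⊙ y  ≡⟨ ⊙≡⊗ x y ⟩
      x ⊗ y  ≡⟨ cong₂ _+√d·_ (re-identity D a b c e) (im-identity a b c e) ⟩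
      y ⊗ x  ≡⟨ ⊙≡⊗ y x ⟨
      y ⊙ x  ∎
      where
      open ≡-Reasoning
      re-identity : ∀ D a b c e → a * c + D * (b * e) ≡ c * a + D * (e * b)
      re-identity = Solver.solve-∀ ℚ-ring
      im-identity : ∀ a b c e → a * e + b * c ≡ c * b + e * a
      im-identity = Solver.solve-∀ ℚ-ring

    ⊙-identityˡ : ∀ x → 1# ⊙ x ≡ x
    ⊙-identityˡ x@(a +√d· b) = trans (⊙≡⊗ 1# x) (cong₂ _+√d·_ (re-identity D a b) (im-identity a b))
      where
      re-identity : ∀ D a b → 1ℚ * a + D * (0ℚ * b) ≡ a
      re-identity = Solver.solve-∀ ℚ-ring
      im-identity : ∀ a b → 1ℚ * b + 0ℚ * a ≡ b
      im-identity = Solver.solve-∀ ℚ-ring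

    ⊙-distribˡ-⊕ : ∀ x y z → x ⊙ (y ⊕ z) ≡ (x ⊙ y) ⊕ (x ⊙ z)
    ⊙-distribˡ-⊕ x@(a +√d· b) y@(c +√d· e) z@(g +√d· h) = begin
      x ⊙ (y ⊕ z)            ≡⟨ ⊙≡⊗ x (y ⊕ z) ⟩
      x ⊗ (y ⊕ z)            ≡⟨ cong₂ _+√d·_ (re-identity D a b c e g h) (im-identity a b c e g h) ⟩
      (x ⊗ y) ⊕ (x ⊗ z)      ≡⟨ cong₂ _⊕_ (⊙≡⊗ x y) (⊙≡⊗ x z) ⟨
      (x ⊙ y) ⊕ (x ⊙ z)      ∎
      where
      open ≡-Reasoning
      re-identity : ∀ D a b c e g h → a * (c + g) + D * (b * (e + h))
                                    ≡ (a * c + D * (b * e)) + (a * g + D * (b * h))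
      re-identity = Solver.solve-∀ ℚ-ring
      im-identity : ∀ a b c e g h → a * (e + h) + b * (c + g) ≡ (a * e + b * c) + (a * h + b * g)
      im-identity = Solver.solve-∀ ℚ-ring

  ⟦suc⟧ : ∀ n → ⟦ suc n ⟧ ≡ ⟦ n ⟧ ⊕ 1#
  ⟦suc⟧ n = cong ι (trans (ℤtoℚ-+ (+ 1) (+ n)) (ℚ.+-comm 1ℚ (ℤtoℚ (+ n))))

  ⟦suc⟧≢0 : ∀ n → ⟦ suc n ⟧ ≢ 0#
  ⟦suc⟧≢0 n = ℤtoℚ-+[1+n]≢0 n ∘ cong re

  ι-homo-⊙ : ∀ p q → ι p ⊙ ι q ≡ ι (p * q)
  ι-homo-⊙ p q = cong₂ _+√d·_ (ℚ.+-identityʳ (p * q)) (cong₂ _+_ (ℚ.*-zeroʳ p) (ℚ.*-zeroˡ q))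

  ι-⊙-·√d : ∀ p q → ι p ⊙ q ·√d ≡ (p * q) ·√d
  ι-⊙-·√d p q = trans (⊙≡⊗ (ι p) (q ·√d)) (cong₂ _+√d·_
    (cong₂ _+_ (ℚ.*-zeroʳ p) (trans (cong (D *_) (ℚ.*-zeroˡ q)) (ℚ.*-zeroʳ D)))
    (ℚ.+-identityʳ (p * q)))

  ·√d-⊙-·√d : ∀ p q → p ·√d ⊙ q ·√d ≡ ι (D * (p * q))
  ·√d-⊙-·√d p q = trans (⊙≡⊗ (p ·√d) (q ·√d)) (cong₂ _+√d·_
    (ℚ.+-identityˡ (D * (p * q)))
    (cong₂ _+_ (ℚ.*-zeroˡ q) (ℚ.*-zeroʳ p)))

  √d⊙√d : √d ⊙ √d ≡ ι D
  √d⊙√d = trans (·√d-⊙-·√d 1ℚ 1ℚ) (cong ι (ℚ.*-identityʳ D))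

  ι-⊙-[·√d⊕1] : ∀ a c → ι a ⊙ (c ·√d ⊕ 1#) ≡ a +√d· (a * c)
  ι-⊙-[·√d⊕1] a c = trans (⊙≡⊗ (ι a) (c ·√d ⊕ 1#)) (cong₂ _+√d·_
    (trans (cong₂ _+_ (ℚ.*-identityʳ a) (trans (cong (D *_) (ℚ.*-zeroˡ (c + 0ℚ))) (ℚ.*-zeroʳ D)))
           (ℚ.+-identityʳ a))
    (trans (cong (λ x → a * x + 0ℚ) (ℚ.+-identityʳ c)) (ℚ.+-identityʳ (a * c))))

  commutativeRing : CommutativeRing 0ℓ 0ℓ
  commutativeRing = record { isCommutativeRing = isCommutativeRing }

  ·√d⊕ι≢ι : ∀ {t} → t ≢ 0ℚ → ∀ p q → t ·√d ⊕ ι p ≢ ι q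
  ·√d⊕ι≢ι {t} t≢0 p q eq = t≢0 (trans (sym (ℚ.+-identityʳ t)) (cong im eq))

  module _ (irr : IrrationalSqrt d) where

    norm≢0 : ∀ {a b} → a +√d· b ≢ 0# → a * a - D * (b * b) ≢ 0ℚ
    norm≢0 {a} {b} a+b√d≢0 norm≡0 with b ℚ.≟ 0ℚ
    ... | yes refl = a+b√d≢0 (cong (_+√d· 0ℚ) ([ id , id ]′ (ℚ-Field.x*y≡0⇒x≡0∨y≡0 a*a≡0)))
      where
      a*a≡0 : a * a ≡ 0ℚ
      a*a≡0 = trans (ℚ-Field.x-y≡0⇒x≡y norm≡0) (ℚ.*-zeroʳ D)
    ... | no b≢0 =
      irr (a * b⁻¹) (square-of-ratio {a} {b} (ℚ.*-inverseʳ b) (ℚ-Field.x-y≡0⇒x≡y norm≡0))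
      where
      instance _ = ≢-nonZero b≢0
      b⁻¹ = 1/ b
      square-of-ratio : ∀ {a b b⁻¹ D} → b * b⁻¹ ≡ 1ℚ → a * a ≡ D * (b * b) →
                        (a * b⁻¹) * (a * b⁻¹) ≡ D
      square-of-ratio {a} {b} {b⁻¹} {D} bb⁻¹≡1 a²≡Db² = begin
        (a * b⁻¹) * (a * b⁻¹)          ≡⟨ Solver.solve (a ∷ b⁻¹ ∷ []) ℚ-ring ⟩
        (a * a) * (b⁻¹ * b⁻¹)          ≡⟨ cong (_* (b⁻¹ * b⁻¹)) a²≡Db² ⟩
        (D * (b * b)) * (b⁻¹ * b⁻¹)    ≡⟨ Solver.solve (D ∷ b ∷ b⁻¹ ∷ []) ℚ-ring ⟩
        D * ((b * b⁻¹) * (b * b⁻¹))    ≡⟨ cong (λ x → D * (x * x)) bb⁻¹≡1 ⟩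
        D * (1ℚ * 1ℚ)                  ≡⟨ ℚ.*-identityʳ D ⟩
        D                              ∎
        where open ≡-Reasoning

    ⊙-inverseʳ : ∀ {x} → x ≢ 0# → x ⊙ inv x ≡ 1#
    ⊙-inverseʳ {x@(a +√d· b)} x≢0 = trans (⊙≡⊗ x (inv x)) (cong₂ _+√d·_
      (trans (re-identity D a b (qinv {d} N)) (*-qinv (norm≢0 x≢0)))
      (im-identity a b (qinv {d} N)))
      where
      N = a * a - D * (b * b)
      re-identity : ∀ D a b n → a * (a * n) + D * (b * - (b * n)) ≡ (a * a - D * (b * b)) * n
      re-identity = Solver.solve-∀ ℚ-ring
      im-identity : ∀ a b n → a * - (b * n) + b * (a * n) ≡ 0ℚ
      im-identity = Solver.solve-∀ ℚ-ring
      *-qinv : ∀ {q} → q ≢ 0ℚ → q * qinv {d} q ≡ 1ℚ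
      *-qinv {q} q≢0 with q ℚ.≟ 0ℚ
      ... | yes q≡0 = ⊥-elim (q≢0 q≡0)
      ... | no q≢0′ = ℚ.*-inverseʳ q {{≢-nonZero q≢0′}}

    ⊙-inverse : ∀ {x} → x ≢ 0# → ∃ λ y → x ⊙ y ≡ 1#
    ⊙-inverse {x} x≢0 = inv x , ⊙-inverseʳ x≢0

module SDMaps {d : ℤ} (irr : IrrationalSqrt d) where

  open QuadraticField d
  open DiscreteField isCommutativeRing _≟_ (⊙-inverse irr)
    using ( x-y≡0⇒x≡y; x≡y⇒x-y≡0; x*y≡0⇒y≡0; x*y≡0⇒x≡0∨y≡0; x*y≢0
          ; *-cancelʳ-≢0; *-cancelˡ-≢0; *-inverse-cancelʳ )
  open CommutativeRing commutativeRing
    using (zeroˡ; zeroʳ; *-identityˡ; *-identityʳ; *-assoc; *-comm; *-commutativeSemigroup)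
    renaming (ring to ringBundle)
  open import Algebra.Properties.Ring ringBundle using (-1*x≈-x)
  open import Algebra.Properties.CommutativeSemigroup *-commutativeSemigroup using (xy∙z≈y∙xz)

  infixl 6 _+_ _-_
  infixl 7 _*_
  infix 8 -_

  -- Tactic.RingSolver only recognises operations that are defined in the module it is called from.
  -_ : Op₁ (QSqrt d)
  -_ = ⊖_

  _+_ _*_ _-_ : Op₂ (QSqrt d)
  _+_ = _⊕_
  _*_ = _⊙_
  _-_ = _⊖_

  ring : AlmostCommutativeRing 0ℓ 0ℓ
  ring = fromCommutativeRing commutativeRing (λ x → dec⇒maybe (0# ≟ x))

  x-y≢0 : ∀ {x y} → x ≢ y → x - y ≢ 0#
  x-y≢0 x≢y = x≢y ∘ x-y≡0⇒x≡y

  x*x≡y*y⇒x≡y∨x≡-y : ∀ {x y} → x * x ≡ y * y → x ≡ y ⊎ x ≡ - y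
  x*x≡y*y⇒x≡y∨x≡-y {x} {y} xx≡yy = Sum.map x-y≡0⇒x≡y x-y≡0⇒x≡y (x*y≡0⇒x≡0∨y≡0 (begin
    (x - y) * (x - - y)  ≡⟨ Solver.solve (x ∷ y ∷ []) ring ⟩
    x * x - y * y        ≡⟨ x≡y⇒x-y≡0 xx≡yy ⟩
    0#                   ∎))
    where open ≡-Reasoning

  ⊘-*-cancelʳ : ∀ {x y} → y ≢ 0# → (x ⊘ y) * y ≡ x
  ⊘-*-cancelʳ {x} {y} y≢0 =
    trans (cong (_* y) (sym (⊙≡⊗ x (inv y)))) (*-inverse-cancelʳ (⊙-inverseʳ irr y≢0))

  ⊘-unique : ∀ {x y u} → y ≢ 0# → x ≡ u * y → x ⊘ y ≡ u
  ⊘-unique y≢0 x≡uy = *-cancelʳ-≢0 y≢0 (trans (⊘-*-cancelʳ y≢0) x≡uy)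

  divide : ∀ x {y} → y ≢ 0# → ∃ λ u → x ≡ u * y
  divide x {y} y≢0 = x ⊘ y , sym (⊘-*-cancelʳ y≢0)

  square-irrational : ∀ {t} → t ≢ 0ℚ → ∀ p → (t ·√d + 1#) * (t ·√d + 1#) ≢ ι p
  square-irrational {t} t≢0 p eq =
    ·√d⊕ι≢ι (x+x≢0 t≢0) (D ℚ.* (t ℚ.* t) ℚ.+ 1ℚ) p (trans (sym expansion) eq)
    where
    square : ∀ v → (v + 1#) * (v + 1#) ≡ (v + v) + (v * v + 1#)
    square = Solver.solve-∀ ring
    expansion : (t ·√d + 1#) * (t ·√d + 1#) ≡ (t ℚ.+ t) ·√d + ι (D ℚ.* (t ℚ.* t) ℚ.+ 1ℚ)
    expansion = trans (square (t ·√d)) (cong (λ z → (t ·√d + t ·√d) + (z + 1#)) (·√d-⊙-·√d t t))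

  square-of-inverse : ∀ {G Y} → G * Y ≡ 1# → G ≡ Y ⊎ G ≡ - Y → Y * Y ≡ 1# ⊎ Y * Y ≡ - 1#
  square-of-inverse GY≡1 (inj₁ refl)       = inj₁ GY≡1
  square-of-inverse {Y = Y} GY≡1 (inj₂ refl) = inj₂ (begin
    Y * Y          ≡⟨ Solver.solve (Y ∷ []) ring ⟩
    - (- Y * Y)    ≡⟨ cong -_ GY≡1 ⟩
    - 1#           ∎)
    where open ≡-Reasoning

  module SDMap (f : QSqrt d → QSqrt d) (sd : IsSDMap d f) where

    Fixed : QSqrt d → Set
    Fixed x = f x ≡ x

    f-injective : ∀ {x y} → x ≢ y → f x ≢ f y
    f-injective {x} {y} x≢y = proj₁ (sd x y x≢y)

    f-sd : ∀ {x y u} → x ≢ y → x + y ≡ u * (x - y) → f u * (f x - f y) ≡ f x + f y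
    f-sd {x} {y} {u} x≢y x+y≡u[x-y] = begin
      f u * (f x - f y)                          ≡⟨ cong (λ z → f z * (f x - f y)) x⊘y≡u ⟨
      f ((x ⊕ y) ⊘ (x ⊖ y)) * (f x - f y)        ≡⟨ cong (_* (f x - f y)) (proj₂ (sd x y x≢y)) ⟩
      ((f x ⊕ f y) ⊘ (f x ⊖ f y)) * (f x - f y)  ≡⟨ ⊘-*-cancelʳ (x-y≢0 (f-injective x≢y)) ⟩
      f x + f y                                  ∎
      where
      open ≡-Reasoning
      x⊘y≡u = ⊘-unique (x-y≢0 x≢y) x+y≡u[x-y]

    f-1 : Fixed 1#
    f-1 = one (f-sd {1#} {0#} {1#} (λ ()) refl) (f-sd {⟦ 2 ⟧} {0#} {1#} (λ ()) refl)
              (f-injective {1#} {⟦ 2 ⟧} (λ ()))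
      where
      one : ∀ {a b c} → c * (c - a) ≡ c + a → c * (b - a) ≡ b + a → c ≢ b → c ≡ 1#
      one {a} {b} {c} e₁ e₂ c≢b =
        [ x-y≡0⇒x≡y , ⊥-elim ∘ c≢b ∘ x-y≡0⇒x≡y ]′ (x*y≡0⇒x≡0∨y≡0 (begin
        (c - 1#) * (c - b)
          ≡⟨ Solver.solve (a ∷ b ∷ c ∷ []) ring ⟩
        (c * (c - a) - (c + a)) - (c * (b - a) - (b + a))
          ≡⟨ cong₂ _-_ (x≡y⇒x-y≡0 e₁) (x≡y⇒x-y≡0 e₂) ⟩
        0# - 0#
          ≡⟨⟩
        0#
          ∎))
        where open ≡-Reasoning

    f-0 : Fixed 0#
    f-0 = x*y≡0⇒y≡0 {⟦ 2 ⟧} (λ ()) (twice {f 0#} sd[1,0])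
      where
      sd[1,0] : 1# * (1# - f 0#) ≡ 1# + f 0#
      sd[1,0] = subst (λ c → c * (c - f 0#) ≡ c + f 0#) f-1 (f-sd {1#} {0#} {1#} (λ ()) refl)
      twice : ∀ {a} → 1# * (1# - a) ≡ 1# + a → ⟦ 2 ⟧ * a ≡ 0#
      twice {a} e = begin
        ⟦ 2 ⟧ * a                  ≡⟨ Solver.solve (a ∷ []) ring ⟩
        (1# + a) - 1# * (1# - a)   ≡⟨ x≡y⇒x-y≡0 (sym e) ⟩
        0#                         ∎
        where open ≡-Reasoning

    f-[-1] : Fixed (- 1#)
    f-[-1] = *-cancelʳ-≢0 {z = 0# - 1#} (λ ()) (begin
      f (- 1#) * (0# - 1#)      ≡⟨ cong₂ (λ p q → f (- 1#) * (p - q)) f-0 f-1 ⟨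
      f (- 1#) * (f 0# - f 1#)  ≡⟨ f-sd {0#} {1#} { - 1#} (λ ()) refl ⟩
      f 0# + f 1#               ≡⟨ cong₂ _+_ f-0 f-1 ⟩
      - 1# * (0# - 1#)          ∎)
      where open ≡-Reasoning

    f-sd-1 : ∀ {x u} → x ≢ 1# → x + 1# ≡ u * (x - 1#) → f u * (f x - 1#) ≡ f x + 1#
    f-sd-1 {x} {u} x≢1 x+1≡u[x-1] = subst (λ c → f u * (f x - c) ≡ f x + c) f-1 (f-sd x≢1 x+1≡u[x-1])

    f-homo-*-generic : ∀ {x y} → x ≢ 0# → y ≢ 1# → f (x * y) ≡ f x * f y
    f-homo-*-generic {x} {y} x≢0 y≢1 =
      sd-product {f (x * y)} {f x} {f y} {f u}
        (f-sd-1 y≢1 y+1≡u[y-1]) (f-sd (xy≢x x≢0 y≢1) (scale {x} {y} {u} y+1≡u[y-1]))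
      where
      u = proj₁ (divide (y + 1#) (x-y≢0 y≢1))
      y+1≡u[y-1] = proj₂ (divide (y + 1#) (x-y≢0 y≢1))

      sd-product : ∀ {A B C F} → F * (C - 1#) ≡ C + 1# → F * (A - B) ≡ A + B → A ≡ B * C
      sd-product {A} {B} {C} {F} e₁ e₂ = x-y≡0⇒x≡y (x*y≡0⇒y≡0 {⟦ 2 ⟧} (λ ()) (begin
        ⟦ 2 ⟧ * (A - B * C)
          ≡⟨ Solver.solve (A ∷ B ∷ C ∷ []) ring ⟩
        (C + 1#) * (A - B) - (A + B) * (C - 1#)
          ≡⟨ cong₂ (λ p q → p * (A - B) - q * (C - 1#)) e₁ e₂ ⟨
        (F * (C - 1#)) * (A - B) - (F * (A - B)) * (C - 1#)
          ≡⟨ Solver.solve (A ∷ B ∷ C ∷ F ∷ []) ring ⟩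
        0#
          ∎))
        where open ≡-Reasoning

      xy≢x : ∀ {x y} → x ≢ 0# → y ≢ 1# → x * y ≢ x
      xy≢x {x} {y} x≢0 y≢1 xy≡x = x*y≢0 x≢0 (x-y≢0 y≢1) (begin
        x * (y - 1#)  ≡⟨ Solver.solve (x ∷ y ∷ []) ring ⟩
        x * y - x     ≡⟨ x≡y⇒x-y≡0 xy≡x ⟩
        0#            ∎)
        where open ≡-Reasoning

      scale : ∀ {x y u} → y + 1# ≡ u * (y - 1#) → x * y + x ≡ u * (x * y - x)
      scale {x} {y} {u} y+1≡u[y-1] = begin
        x * y + x           ≡⟨ Solver.solve (x ∷ y ∷ []) ring ⟩
        x * (y + 1#)        ≡⟨ cong (x *_) y+1≡u[y-1] ⟩
        x * (u * (y - 1#))  ≡⟨ Solver.solve (x ∷ y ∷ u ∷ []) ring ⟩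
        u * (x * y - x)     ∎
        where open ≡-Reasoning

    f-homo-* : ∀ x y → f (x * y) ≡ f x * f y
    f-homo-* x y with x ≟ 0# | y ≟ 1#
    ... | yes refl | _ = begin
      f (0# * y)  ≡⟨ cong f (zeroˡ y) ⟩
      f 0#        ≡⟨ f-0 ⟩
      0#          ≡⟨ zeroˡ (f y) ⟨
      0# * f y    ≡⟨ cong (_* f y) f-0 ⟨
      f 0# * f y  ∎
      where open ≡-Reasoning
    ... | no _ | yes refl = begin
      f (x * 1#)  ≡⟨ cong f (*-identityʳ x) ⟩
      f x         ≡⟨ *-identityʳ (f x) ⟨
      f x * 1#    ≡⟨ cong (f x *_) f-1 ⟨
      f x * f 1#  ∎
      where open ≡-Reasoning
    ... | no x≢0 | no y≢1 = f-homo-*-generic x≢0 y≢1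

    f-homo‿- : ∀ x → f (- x) ≡ - f x
    f-homo‿- x = begin
      f (- x)         ≡⟨ cong f (-1*x≈-x x) ⟨
      f (- 1# * x)    ≡⟨ f-homo-* (- 1#) x ⟩
      f (- 1#) * f x  ≡⟨ cong (_* f x) f-[-1] ⟩
      - 1# * f x      ≡⟨ -1*x≈-x (f x) ⟩
      - f x           ∎
      where open ≡-Reasoning

    f-shift : ∀ v → f (v + 1#) * (f v - 1#) ≡ f (v - 1#) * (f v + 1#)
    f-shift v with v ≟ 1#
    ... | yes refl = begin
      f (1# + 1#) * (f 1# - 1#)  ≡⟨ cong (λ z → f (1# + 1#) * (z - 1#)) f-1 ⟩
      f (1# + 1#) * 0#           ≡⟨ zeroʳ (f (1# + 1#)) ⟩
      0#                         ≡⟨ zeroˡ (f 1# + 1#) ⟨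
      0# * (f 1# + 1#)           ≡⟨ cong (_* (f 1# + 1#)) f-0 ⟨
      f (1# - 1#) * (f 1# + 1#)  ∎
      where open ≡-Reasoning
    ... | no v≢1 = begin
      f (v + 1#) * (f v - 1#)          ≡⟨ cong (λ z → f z * (f v - 1#)) v+1≡w[v-1] ⟩
      f (w * (v - 1#)) * (f v - 1#)    ≡⟨ cong (_* (f v - 1#)) (f-homo-* w (v - 1#)) ⟩
      (f w * f (v - 1#)) * (f v - 1#)  ≡⟨ xy∙z≈y∙xz (f w) (f (v - 1#)) (f v - 1#) ⟩
      f (v - 1#) * (f w * (f v - 1#))  ≡⟨ cong (f (v - 1#) *_) (f-sd-1 v≢1 v+1≡w[v-1]) ⟩
      f (v - 1#) * (f v + 1#)          ∎
      where
      open ≡-Reasoning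
      w = proj₁ (divide (v + 1#) (x-y≢0 v≢1))
      v+1≡w[v-1] = proj₂ (divide (v + 1#) (x-y≢0 v≢1))

    f-step : ∀ {v} → v - 1# ≢ 0# → Fixed (v - 1#) → Fixed v → Fixed (v + 1#)
    f-step {v} v-1≢0 f[v-1]≡v-1 fv≡v = *-cancelʳ-≢0 v-1≢0 (begin
      f (v + 1#) * (v - 1#)    ≡⟨ cong (λ z → f (v + 1#) * (z - 1#)) fv≡v ⟨
      f (v + 1#) * (f v - 1#)  ≡⟨ f-shift v ⟩
      f (v - 1#) * (f v + 1#)  ≡⟨ cong₂ (λ p q → p * (q + 1#)) f[v-1]≡v-1 fv≡v ⟩
      (v - 1#) * (v + 1#)      ≡⟨ *-comm (v - 1#) (v + 1#) ⟩
      (v + 1#) * (v - 1#)      ∎)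
      where open ≡-Reasoning

    -- Eliminating b = (a + 1)/(a - 1) and e = (b + a)/(b - a) from the middle equation
    -- leaves 2a(a + 1)(a² + 1)(a - 2) = 0.
    eliminate : ∀ {a b e} → a ≢ 0# → a ≢ - 1# → a * a ≢ - 1# →
                b * (a - 1#) ≡ a + 1# → e * (a * a - 1#) ≡ b * (a * a + 1#) →
                (a * b) * (e - 1#) ≡ (a * a) * (e + 1#) → a ≡ ⟦ 2 ⟧
    eliminate {a} {b} {e} a≢0 a≢-1 a²≢-1 e₁ e₂ e₃ = x-y≡0⇒x≡y (x*y≡0⇒y≡0 nonzero (begin
        ⟦ 2 ⟧ * a * (a + 1#) * (a * a + 1#) * (a - ⟦ 2 ⟧)
      ≡⟨ Solver.solve (a ∷ b ∷ e ∷ []) ring ⟩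
        ((a - 1#) * (e - 1#) * (a * a - 1#) + (a * a + 1#) * (1# + ⟦ 2 ⟧ * a - a * a))
          * (b * (a - 1#) - (a + 1#))
        + (a - 1#) * (1# + ⟦ 2 ⟧ * a - a * a) * (e * (a * a - 1#) - b * (a * a + 1#))
        - (a - 1#) * (a - 1#) * (a * a - 1#) * (b * (e - 1#) - a * (e + 1#))
      ≡⟨ combination P Q R (x≡y⇒x-y≡0 e₁) (x≡y⇒x-y≡0 e₂) (x≡y⇒x-y≡0 e₃′) ⟩
        0#
      ∎))
      where
      open ≡-Reasoning
      e₃′ : b * (e - 1#) ≡ a * (e + 1#)
      e₃′ = *-cancelˡ-≢0 a≢0 (trans (sym (*-assoc a b (e - 1#))) (trans e₃ (*-assoc a a (e + 1#))))
      nonzero : ⟦ 2 ⟧ * a * (a + 1#) * (a * a + 1#) ≢ 0#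
      nonzero = x*y≢0 (x*y≢0 (x*y≢0 {⟦ 2 ⟧} {a} (λ ()) a≢0) (a≢-1 ∘ x-y≡0⇒x≡y))
                      (a²≢-1 ∘ x-y≡0⇒x≡y)
      P Q R : QSqrt d
      P = (a - 1#) * (e - 1#) * (a * a - 1#) + (a * a + 1#) * (1# + ⟦ 2 ⟧ * a - a * a)
      Q = (a - 1#) * (1# + ⟦ 2 ⟧ * a - a * a)
      R = (a - 1#) * (a - 1#) * (a * a - 1#)
      combination : ∀ p q r {x y z} → x ≡ 0# → y ≡ 0# → z ≡ 0# → p * x + q * y - r * z ≡ 0#
      combination p q r refl refl refl = Solver.solve (p ∷ q ∷ r ∷ []) ring

    f-2 : Fixed ⟦ 2 ⟧
    f-2 = eliminate {a} {b} {e} a≢0 a≢-1 a²≢-1 shift₂ shift₄ shift₅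
      where
      a = f ⟦ 2 ⟧
      b = f ⟦ 3 ⟧
      e = f ⟦ 5 ⟧
      f-4 : f ⟦ 4 ⟧ ≡ a * a
      f-4 = f-homo-* ⟦ 2 ⟧ ⟦ 2 ⟧
      f-6 : f ⟦ 6 ⟧ ≡ a * b
      f-6 = f-homo-* ⟦ 2 ⟧ ⟦ 3 ⟧
      shift₂ : b * (a - 1#) ≡ a + 1#
      shift₂ = trans (f-shift ⟦ 2 ⟧) (trans (cong (_* (a + 1#)) f-1) (*-identityˡ (a + 1#)))
      shift₄ : e * (a * a - 1#) ≡ b * (a * a + 1#)
      shift₄ = subst (λ z → e * (z - 1#) ≡ b * (z + 1#)) f-4 (f-shift ⟦ 4 ⟧)
      shift₅ : (a * b) * (e - 1#) ≡ (a * a) * (e + 1#)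
      shift₅ = subst₂ (λ z w → z * (e - 1#) ≡ w * (e + 1#)) f-6 f-4 (f-shift ⟦ 5 ⟧)
      a≢0 : a ≢ 0#
      a≢0 a≡0 = f-injective {⟦ 2 ⟧} {0#} (λ ()) (trans a≡0 (sym f-0))
      a≢-1 : a ≢ - 1#
      a≢-1 a≡-1 = f-injective {⟦ 2 ⟧} { - 1#} (λ ()) (trans a≡-1 (sym f-[-1]))
      a²≢-1 : a * a ≢ - 1#
      a²≢-1 a²≡-1 = f-injective {⟦ 4 ⟧} { - 1#} (λ ()) (trans (trans f-4 a²≡-1) (sym f-[-1]))

    f-⟦⟧ : ∀ n → Fixed ⟦ n ⟧
    f-⟦⟧ zero    = f-0
    f-⟦⟧ (suc n) = proj₁ (consecutive n)
      where
      pred : ∀ n → ⟦ suc n ⟧ - 1# ≡ ⟦ n ⟧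
      pred n = trans (cong (_- 1#) (⟦suc⟧ n)) (cancel ⟦ n ⟧)
        where
        cancel : ∀ x → x + 1# - 1# ≡ x
        cancel = Solver.solve-∀ ring
      consecutive : ∀ n → Fixed ⟦ suc n ⟧ × Fixed ⟦ suc (suc n) ⟧
      consecutive zero    = f-1 , f-2
      consecutive (suc n) = fixed₂ , subst Fixed (sym (⟦suc⟧ (suc (suc n))))
        (f-step (subst (_≢ 0#) (sym (pred (suc n))) (⟦suc⟧≢0 n))
                (subst Fixed (sym (pred (suc n))) fixed₁) fixed₂)
        where
        fixed₁ = proj₁ (consecutive n)
        fixed₂ = proj₂ (consecutive n)

    f-ℤ : ∀ i → Fixed (ι (ℤtoℚ i))
    f-ℤ (+ n)    = f-⟦⟧ n
    f-ℤ -[1+ n ] = trans (f-homo‿- ⟦ suc n ⟧) (cong -_ (f-⟦⟧ (suc n)))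

    f-ι : ∀ q → Fixed (ι q)
    f-ι q = *-cancelʳ-≢0 (⟦suc⟧≢0 (ℚ.denominator-1 q)) (begin
      f (ι q) * ι (ℤtoℚ (↧ q))       ≡⟨ cong (f (ι q) *_) (f-ℤ (↧ q)) ⟨
      f (ι q) * f (ι (ℤtoℚ (↧ q)))   ≡⟨ f-homo-* (ι q) (ι (ℤtoℚ (↧ q))) ⟨
      f (ι q * ι (ℤtoℚ (↧ q)))       ≡⟨ cong f ι[q]*↧q≡↥q ⟩
      f (ι (ℤtoℚ (↥ q)))             ≡⟨ f-ℤ (↥ q) ⟩
      ι (ℤtoℚ (↥ q))                 ≡⟨ ι[q]*↧q≡↥q ⟨
      ι q * ι (ℤtoℚ (↧ q))           ∎)
      where
      open ≡-Reasoning
      ι[q]*↧q≡↥q : ι q * ι (ℤtoℚ (↧ q)) ≡ ι (ℤtoℚ (↥ q))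
      ι[q]*↧q≡↥q = trans (ι-homo-⊙ q (ℤtoℚ (↧ q))) (cong ι (*-ℤtoℚ-↧ q))

    f-shift-sign : ∀ {v w} → f v ≡ w → f (v * v - 1#) ≡ w * w - 1# → w - 1# ≢ 0# →
                   f (v + 1#) ≡ w + 1# ⊎ f (v + 1#) ≡ - (w + 1#)
    f-shift-sign {v} {w} fv≡w f[v²-1]≡w²-1 w-1≢0 = x*x≡y*y⇒x≡y∨x≡-y (*-cancelʳ-≢0 w-1≢0 (begin
      (P * P) * (w - 1#)                ≡⟨ *-assoc P P (w - 1#) ⟩
      P * (P * (w - 1#))                ≡⟨ cong (P *_) shift ⟩
      P * (Q * (w + 1#))                ≡⟨ *-assoc P Q (w + 1#) ⟨
      (P * Q) * (w + 1#)                ≡⟨ cong (_* (w + 1#)) product ⟩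
      (w * w - 1#) * (w + 1#)           ≡⟨ Solver.solve (w ∷ []) ring ⟩
      ((w + 1#) * (w + 1#)) * (w - 1#)  ∎))
      where
      open ≡-Reasoning
      P = f (v + 1#)
      Q = f (v - 1#)
      shift : P * (w - 1#) ≡ Q * (w + 1#)
      shift = subst (λ z → P * (z - 1#) ≡ Q * (z + 1#)) fv≡w (f-shift v)
      product : P * Q ≡ w * w - 1#
      product = begin
        P * Q                     ≡⟨ f-homo-* (v + 1#) (v - 1#) ⟨
        f ((v + 1#) * (v - 1#))   ≡⟨ cong f (Solver.solve (v ∷ []) ring) ⟩
        f (v * v - 1#)            ≡⟨ f[v²-1]≡w²-1 ⟩
        w * w - 1#                ∎

    f-shift-wrong-sign : ∀ {v w} → f v ≡ w → f (v + 1#) ≡ - (w + 1#) →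
                         f ((v + v) + 1#) * ((w + w) + 1#) ≡ 1#
    f-shift-wrong-sign {v} {w} fv≡w f[v+1]≡-[w+1] =
      solve-for-G {G} {w} (*-cancelˡ-≢0 {z = ⟦ 2 ⟧} (λ ()) (begin
      ⟦ 2 ⟧ * (- (w + 1#) * (G - 1#))    ≡⟨ *-assoc ⟦ 2 ⟧ (- (w + 1#)) (G - 1#) ⟨
      ⟦ 2 ⟧ * - (w + 1#) * (G - 1#)      ≡⟨ cong (λ z → ⟦ 2 ⟧ * z * (G - 1#)) f[v+1]≡-[w+1] ⟨
      ⟦ 2 ⟧ * f (v + 1#) * (G - 1#)      ≡⟨ cong (_* (G - 1#)) (f-double (v + 1#)) ⟨
      f (⟦ 2 ⟧ * (v + 1#)) * (G - 1#)    ≡⟨ cong (λ z → f z * (G - 1#)) 2[v+1]≡u+1 ⟩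
      f (u + 1#) * (f u - 1#)            ≡⟨ f-shift u ⟩
      f (u - 1#) * (f u + 1#)            ≡⟨ cong (λ z → f z * (G + 1#)) u-1≡2v ⟩
      f (⟦ 2 ⟧ * v) * (G + 1#)           ≡⟨ cong (_* (G + 1#)) (f-double v) ⟩
      ⟦ 2 ⟧ * f v * (G + 1#)             ≡⟨ cong (λ z → ⟦ 2 ⟧ * z * (G + 1#)) fv≡w ⟩
      ⟦ 2 ⟧ * w * (G + 1#)               ≡⟨ *-assoc ⟦ 2 ⟧ w (G + 1#) ⟩
      ⟦ 2 ⟧ * (w * (G + 1#))             ∎))
      where
      open ≡-Reasoning
      u = (v + v) + 1#
      G = f u
      2[v+1]≡u+1 : ⟦ 2 ⟧ * (v + 1#) ≡ ((v + v) + 1#) + 1#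
      2[v+1]≡u+1 = Solver.solve (v ∷ []) ring
      u-1≡2v : ((v + v) + 1#) - 1# ≡ ⟦ 2 ⟧ * v
      u-1≡2v = Solver.solve (v ∷ []) ring
      f-double : ∀ x → f (⟦ 2 ⟧ * x) ≡ ⟦ 2 ⟧ * f x
      f-double x = trans (f-homo-* ⟦ 2 ⟧ x) (cong (_* f x) f-2)
      solve-for-G : ∀ {G w} → - (w + 1#) * (G - 1#) ≡ w * (G + 1#) → G * ((w + w) + 1#) ≡ 1#
      solve-for-G {G} {w} eq = x-y≡0⇒x≡y (begin
        G * ((w + w) + 1#) - 1#                        ≡⟨ Solver.solve (G ∷ w ∷ []) ring ⟩
        w * (G + 1#) - - (w + 1#) * (G - 1#)           ≡⟨ x≡y⇒x-y≡0 (sym eq) ⟩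
        0#                                             ∎)

    f-√d : f √d ≡ √d ⊎ f √d ≡ - √d
    f-√d = x*x≡y*y⇒x≡y∨x≡-y (begin
      f √d * f √d  ≡⟨ f-homo-* √d √d ⟨
      f (√d * √d)  ≡⟨ cong f √d⊙√d ⟩
      f (ι D)      ≡⟨ f-ι D ⟩
      ι D          ≡⟨ √d⊙√d ⟨
      √d * √d      ∎)
      where open ≡-Reasoning

    module _ (s : ℚ) (s*s≡1 : s ℚ.* s ≡ 1ℚ) (f√d≡s√d : f √d ≡ s ·√d) where

      f-·√d : ∀ q → f (q ·√d) ≡ (q ℚ.* s) ·√d
      f-·√d q = begin
        f (q ·√d)           ≡⟨ cong f (trans (ι-⊙-·√d q 1ℚ) (cong _·√d (ℚ.*-identityʳ q))) ⟨
        f (ι q * √d)        ≡⟨ f-homo-* (ι q) √d ⟩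
        f (ι q) * f √d      ≡⟨ cong₂ _*_ (f-ι q) f√d≡s√d ⟩
        ι q * s ·√d         ≡⟨ ι-⊙-·√d q s ⟩
        (q ℚ.* s) ·√d       ∎
        where open ≡-Reasoning

      s≢0 : s ≢ 0ℚ
      s≢0 s≡0 = ℚ.1≢0 (trans (sym s*s≡1) (cong (λ t → t ℚ.* t) s≡0))

      f-·√d+1-sign : ∀ {q} → q ≢ 0ℚ → f (q ·√d + 1#) ≡ (q ℚ.* s) ·√d + 1#
                                    ⊎ f (q ·√d + 1#) ≡ - ((q ℚ.* s) ·√d + 1#)
      f-·√d+1-sign {q} q≢0 = f-shift-sign (f-·√d q) fixed-square
        (·√d⊕ι≢ι (ℚ-Field.x*y≢0 q≢0 s≢0) (ℚ.- 1ℚ) 0ℚ)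
        where
        qs*qs≡q*q : (q ℚ.* s) ℚ.* (q ℚ.* s) ≡ q ℚ.* q
        qs*qs≡q*q = begin
          (q ℚ.* s) ℚ.* (q ℚ.* s)  ≡⟨ Solver.solve (q ∷ s ∷ []) ℚ-ring ⟩
          (q ℚ.* q) ℚ.* (s ℚ.* s)  ≡⟨ cong ((q ℚ.* q) ℚ.*_) s*s≡1 ⟩
          (q ℚ.* q) ℚ.* 1ℚ         ≡⟨ ℚ.*-identityʳ (q ℚ.* q) ⟩
          q ℚ.* q                  ∎
          where open ≡-Reasoning
        fixed-square : f (q ·√d * q ·√d - 1#) ≡ (q ℚ.* s) ·√d * (q ℚ.* s) ·√d - 1#
        fixed-square = begin
          f (q ·√d * q ·√d - 1#)
            ≡⟨ cong (λ z → f (z - 1#)) (·√d-⊙-·√d q q) ⟩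
          f (ι (D ℚ.* (q ℚ.* q)) - 1#)
            ≡⟨ f-ι (D ℚ.* (q ℚ.* q) ℚ.- 1ℚ) ⟩
          ι (D ℚ.* (q ℚ.* q)) - 1#
            ≡⟨ cong (λ z → ι (D ℚ.* z) - 1#) qs*qs≡q*q ⟨
          ι (D ℚ.* ((q ℚ.* s) ℚ.* (q ℚ.* s))) - 1#
            ≡⟨ cong (_- 1#) (·√d-⊙-·√d (q ℚ.* s) (q ℚ.* s)) ⟨
          (q ℚ.* s) ·√d * (q ℚ.* s) ·√d - 1#
            ∎
          where open ≡-Reasoning

      f-·√d+1 : ∀ q → f (q ·√d + 1#) ≡ (q ℚ.* s) ·√d + 1#
      f-·√d+1 q with q ℚ.≟ 0ℚ
      ... | yes refl = trans f-1 (cong (λ t → t ·√d + 1#) (sym (ℚ.*-zeroˡ s)))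
      ... | no q≢0  = [ id , ⊥-elim ∘ wrong-sign ]′ (f-·√d+1-sign q≢0)
        where
        q+q≢0 = x+x≢0 q≢0
        Y = ((q ℚ.+ q) ℚ.* s) ·√d + 1#
        Y-irrational : ∀ p → Y * Y ≢ ι p
        Y-irrational = square-irrational (ℚ-Field.x*y≢0 q+q≢0 s≢0)
        wrong-sign : f (q ·√d + 1#) ≡ - ((q ℚ.* s) ·√d + 1#) → ⊥
        wrong-sign eq = [ Y-irrational 1ℚ , Y-irrational (ℚ.- 1ℚ) ]′
          (square-of-inverse {f ((q ℚ.+ q) ·√d + 1#)} {Y} GY≡1 (f-·√d+1-sign q+q≢0))
          where
          GY≡1 : f ((q ℚ.+ q) ·√d + 1#) * Y ≡ 1#
          GY≡1 = subst (λ t → f ((q ℚ.+ q) ·√d + 1#) * (t ·√d + 1#) ≡ 1#)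
                       (sym (ℚ.*-distribʳ-+ s q q)) (f-shift-wrong-sign (f-·√d q) eq)

      f-decomposition : ∀ a b → f (a +√d· b) ≡ a +√d· (b ℚ.* s)
      f-decomposition a b with a ℚ.≟ 0ℚ
      ... | yes refl = f-·√d b
      ... | no a≢0  = begin
        f (a +√d· b)                ≡⟨ cong f (trans (ι-⊙-[·√d⊕1] a c) (cong (a +√d·_) a*c≡b)) ⟨
        f (ι a * (c ·√d + 1#))      ≡⟨ f-homo-* (ι a) (c ·√d + 1#) ⟩
        f (ι a) * f (c ·√d + 1#)    ≡⟨ cong₂ _*_ (f-ι a) (f-·√d+1 c) ⟩
        ι a * ((c ℚ.* s) ·√d + 1#)  ≡⟨ ι-⊙-[·√d⊕1] a (c ℚ.* s) ⟩
        a +√d· (a ℚ.* (c ℚ.* s))    ≡⟨ cong (a +√d·_) a*[c*s]≡b*s ⟩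
        a +√d· (b ℚ.* s)            ∎
        where
        open ≡-Reasoning
        instance _ = ≢-nonZero a≢0
        c = b ℚ.* 1/ a
        a*c≡b : a ℚ.* c ≡ b
        a*c≡b = trans (ℚ.*-comm a c) (ℚ-Field.*-inverse-cancelʳ (ℚ.*-inverseʳ a))
        a*[c*s]≡b*s : a ℚ.* (c ℚ.* s) ≡ b ℚ.* s
        a*[c*s]≡b*s = trans (sym (ℚ.*-assoc a c s)) (cong (ℚ._* s) a*c≡b)

theorem5p3 : (d : ℤ) → IrrationalSqrt d → (f : QSqrt d → QSqrt d) → IsSDMap d f →
    ((z : QSqrt d) → f z ≡ z) ⊎ ((z : QSqrt d) → f z ≡ conj z)
theorem5p3 d irr f sd = Sum.map identity conjugation f-√d
  where
  open QuadraticField d using (_·√d)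
  open SDMaps {d} irr
  open SDMap f sd
  identity : f (1ℚ ·√d) ≡ 1ℚ ·√d → ∀ z → f z ≡ z
  identity f√d≡√d (a +√d· b) =
    trans (f-decomposition 1ℚ refl f√d≡√d a b) (cong (a +√d·_) (ℚ.*-identityʳ b))
  conjugation : f (1ℚ ·√d) ≡ (ℚ.- 1ℚ) ·√d → ∀ z → f z ≡ conj z
  conjugation f√d≡-√d (a +√d· b) =
    trans (f-decomposition (ℚ.- 1ℚ) refl f√d≡-√d a b) (cong (a +√d·_) (Solver.solve (b ∷ []) ℚ-ring))
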